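{- Let $n\ge0$ be an integer and let $A_{ij}$ ($i,j\ge0$) be the coefficient of the monomial $u^iv^jw^{n+1-i-j}$ in the numerator $P_{1/(n+1)}(u,v,w)$ of the Markov polynomial $M_{1/(n+1)}$ (equivalently, the coefficient of $x^{2i}y^{2j}z^{2(n+1-i-j)}$ in $x^{0}y^{n}z^{n+1}M_{1/(n+1)}(x,y,z)$), with $A_{ij}=0$ if absent. Then $$A_{ij}=\binom{n-j}{n+1-i-j}\binom{i+j}{j}\qquad\text{for all integers } i,j\ge0.$$
   Context: Binomial convention: for integers $m$ and $k$, $\binom mk=\frac{m(m-1)\cdots(m-k+1)}{k!}$ if $k\ge0$ (so $\binom m0=1$ for every $m$) and $\binom mk=0$ if $k<0$. Markov polynomials $M_\rho(x,y,z)$, $\rho\in\mathbb{Q}_{\ge0}\cup\{1/0\}$, are defined recursively by $M_{0/1}=x$, $M_{1/0}=y$, $M_{1/1}=(x^2+y^2)/z$, and: whenever $p/q$, $r/s$ are fractions in lowest terms with $p,q,r,s\ge0$, $qr-ps=1$, mediant $\mu=(p+r)/(q+s)$, then $M_{(2p+r)/(2q+s)}=(M_{p/q}^2+M_\mu^2)/M_{r/s}$ and $M_{(p+2r)/(q+2s)}=(M_\mu^2+M_{r/s}^2)/M_{p/q}$. In particular $M_{1/(k+1)}=(M_{1/k}^2+x^2)/M_{1/(k-1)}$. For coprime positive $a,b$, $M_{a/b}=P_{a/b}(x^2,y^2,z^2)/(x^{a-1}y^{b-1}z^{a+b-1})$ with $P_{a/b}$ homogeneous of degree $a+b-1$ (the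 numerator). -}

module Defs where

open import Data.Nat as ℕ using (ℕ; zero; suc; _∸_; _≤?_)
open import Data.Nat.Properties using (_!≢0)
open import Data.Integer as ℤ using (ℤ; +_; -[1+_])
open import Data.Rational as ℚ using (ℚ; 0ℚ; 1ℚ; _+_; _*_; _÷_)
open import Data.Rational.Properties using (_≟_)
open import Data.List using (List; foldr; map; upTo)
open import Relation.Nullary using (yes; no)

infixr 8 _^_
_^_ : ℚ → ℕ → ℚ
p ^ zero = 1ℚ
p ^ suc k = p * p ^ k

-- total division on ℚ (p ÷ 0 = 0).  In the statement it is only ever applied
-- to strictly positive divisors (all Markov values are positive at positive
-- x,y,z), so the junk value is never used there.
_÷₀_ : ℚ → ℚ → ℚ
p ÷₀ q with q ≟ 0ℚ
... | yes _ = 0ℚ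
... | no q≢0 = _÷_ p q {{ℚ.≢-nonZero q≢0}}

M₁/ : ℕ → ℚ → ℚ → ℚ → ℚ
M₁/ zero x y z = y
M₁/ (suc zero) x y z = (x ^ 2 + y ^ 2) ÷₀ z
M₁/ (suc (suc k)) x y z = (M₁/ (suc k) x y z ^ 2 + x ^ 2) ÷₀ M₁/ k x y z

falling : ℤ → ℕ → ℤ
falling m zero = + 1
falling m (suc k) = m ℤ.* falling (m ℤ.- + 1) k

binom : ℤ → ℤ → ℚ
binom m (+ k) = ℚ._/_ (falling m k) (k ℕ.!) {{k !≢0}}
binom m -[1+ _ ] = 0ℚ

A : ℕ → ℕ → ℕ → ℚ
A n i j = binom (+ n ℤ.- + j) (+ suc n ℤ.- + i ℤ.- + j)
        * binom (+ (i ℕ.+ j)) (+ j)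

Σ< : ℕ → (ℕ → ℚ) → ℚ
Σ< m f = foldr _+_ 0ℚ (map f (upTo m))

{-# OPTIONS --safe #-}
-- Put Q n = yⁿ z^(n+1) M_{1/(n+1)}(x,y,z) and let F n be the claimed expansion.  The exchange
-- relation M_{k+2} M_k = M_{k+1}² + x² makes (M_{k+2} + M_k) / M_{k+1} independent of k, and
-- its value at k = 0 is (x²+y²+z²)/(yz); hence Q (n+2) + y²z² Q n = (x²+y²+z²) Q (n+1).
-- Pascal's rule, applied to both binomials of A, gives
--   A_{n+2}(i,j) + A_n(i,j-1) = A_{n+1}(i-1,j) + A_{n+1}(i,j-1) + A_{n+1}(i,j),
-- which is the same recurrence for F, read off coefficientwise.  Both sequences start with
-- x² + y² and (x² + y²)² + z²x².
module Submission where

open import Defs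
open import Data.Nat using (ℕ; suc; _∸_)
open import Data.Rational using (ℚ; Positive; _*_)
open import Relation.Binary.PropositionalEquality using (_≡_)

open import Data.Nat as ℕ using (zero; _≤_; _<_; _!)
import Data.Nat.Properties as ℕₚ
open import Data.Integer as ℤ using (ℤ; +_; -[1+_]; 1ℤ)
import Data.Integer.Properties as ℤₚ
import Data.Integer.Tactic.RingSolver as ℤ-Solver
open import Data.Empty using (⊥-elim)
open import Data.List using ([]; _∷_; foldr; upTo)
open import Data.List.Properties using (map-applyUpTo; map-cong)
open import Data.Product using (_×_; _,_; proj₁)
open import Data.Rational as ℚ using (_+_; 0ℚ; 1ℚ)
import Data.Rational.Properties as ℚₚ
open import Data.Rational.Unnormalised as ℚᵘ using (mkℚᵘ; *≡*)
import Data.Rational.Unnormalised.Properties as ℚᵘₚ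
open import Function using (_∘_)
open import Level using (0ℓ)
open import Relation.Binary.PropositionalEquality
  using (refl; sym; trans; cong; cong₂; _≢_; module ≡-Reasoning)
open import Relation.Nullary using (yes; no)
open import Relation.Nullary.Decidable using (dec⇒maybe)
open import Tactic.RingSolver using (solve; solve-∀)
open import Tactic.RingSolver.Core.AlmostCommutativeRing
  using (AlmostCommutativeRing; fromCommutativeRing)
open import Algebra.Bundles using (CommutativeMonoid)
open import Algebra.Properties.CommutativeSemigroup
  (CommutativeMonoid.commutativeSemigroup ℚₚ.+-0-commutativeMonoid) using (interchange)
open import Algebra.Properties.CommutativeSemigroup
  (CommutativeMonoid.commutativeSemigroup ℚₚ.*-1-commutativeMonoid) using (x∙yz≈y∙xz)
open import Algebra.Properties.Group ℚₚ.+-0-group using (∙-cancelʳ)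

open ≡-Reasoning

ℚ-ring : AlmostCommutativeRing 0ℓ 0ℓ
ℚ-ring = fromCommutativeRing ℚₚ.+-*-commutativeRing (λ p → dec⇒maybe (0ℚ ℚₚ.≟ p))

-- Finite sums

Σ<-suc : ∀ m (f : ℕ → ℚ) → Σ< (suc m) f ≡ f 0 + Σ< m (f ∘ suc)
Σ<-suc m f = cong (λ xs → f 0 + foldr _+_ 0ℚ xs)
  (trans (map-applyUpTo suc f m) (sym (map-applyUpTo (λ k → k) (f ∘ suc) m)))

Σ<-cong : ∀ m {f g : ℕ → ℚ} → (∀ k → f k ≡ g k) → Σ< m f ≡ Σ< m g
Σ<-cong m f≗g = cong (foldr _+_ 0ℚ) (map-cong f≗g (upTo m))

Σ<-zero : ∀ m (f : ℕ → ℚ) → (∀ k → f k ≡ 0ℚ) → Σ< m f ≡ 0ℚ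
Σ<-zero zero    f _   = refl
Σ<-zero (suc m) f f≡0 = begin
  Σ< (suc m) f             ≡⟨ Σ<-suc m f ⟩
  f 0 + Σ< m (f ∘ suc)     ≡⟨ cong₂ _+_ (f≡0 0) (Σ<-zero m (f ∘ suc) (f≡0 ∘ suc)) ⟩
  0ℚ + 0ℚ                  ∎

Σ<-snoc : ∀ m (f : ℕ → ℚ) → Σ< (suc m) f ≡ Σ< m f + f m
Σ<-snoc zero    f = trans (ℚₚ.+-identityʳ (f 0)) (sym (ℚₚ.+-identityˡ (f 0)))
Σ<-snoc (suc m) f = begin
  Σ< (suc (suc m)) f                   ≡⟨ Σ<-suc (suc m) f ⟩
  f 0 + Σ< (suc m) (f ∘ suc)           ≡⟨ cong (λ s → f 0 + s) (Σ<-snoc m (f ∘ suc)) ⟩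
  f 0 + (Σ< m (f ∘ suc) + f (suc m))   ≡⟨ ℚₚ.+-assoc (f 0) _ _ ⟨
  f 0 + Σ< m (f ∘ suc) + f (suc m)     ≡⟨ cong (_+ f (suc m)) (Σ<-suc m f) ⟨
  Σ< (suc m) f + f (suc m)             ∎

Σ<-extend : ∀ d m (f : ℕ → ℚ) → (∀ k → m ≤ k → f k ≡ 0ℚ) → Σ< (d ℕ.+ m) f ≡ Σ< m f
Σ<-extend zero    m f _   = refl
Σ<-extend (suc d) m f f≡0 = begin
  Σ< (suc d ℕ.+ m) f               ≡⟨ Σ<-snoc (d ℕ.+ m) f ⟩
  Σ< (d ℕ.+ m) f + f (d ℕ.+ m)     ≡⟨ cong₂ _+_ (Σ<-extend d m f f≡0) (f≡0 _ (ℕₚ.m≤n+m m d)) ⟩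
  Σ< m f + 0ℚ                      ≡⟨ ℚₚ.+-identityʳ _ ⟩
  Σ< m f                           ∎

Σ<-+ : ∀ m (f g : ℕ → ℚ) → Σ< m (λ k → f k + g k) ≡ Σ< m f + Σ< m g
Σ<-+ zero    f g = refl
Σ<-+ (suc m) f g = begin
  Σ< (suc m) (λ k → f k + g k)
    ≡⟨ Σ<-suc m (λ k → f k + g k) ⟩
  f 0 + g 0 + Σ< m (λ k → f (suc k) + g (suc k))
    ≡⟨ cong (λ s → f 0 + g 0 + s) (Σ<-+ m (f ∘ suc) (g ∘ suc)) ⟩
  f 0 + g 0 + (Σ< m (f ∘ suc) + Σ< m (g ∘ suc))
    ≡⟨ interchange (f 0) (g 0) _ _ ⟩
  f 0 + Σ< m (f ∘ suc) + (g 0 + Σ< m (g ∘ suc))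
    ≡⟨ cong₂ _+_ (Σ<-suc m f) (Σ<-suc m g) ⟨
  Σ< (suc m) f + Σ< (suc m) g
    ∎

Σ<-*ˡ : ∀ m c (f : ℕ → ℚ) → Σ< m (λ k → c * f k) ≡ c * Σ< m f
Σ<-*ˡ zero    c f = sym (ℚₚ.*-zeroʳ c)
Σ<-*ˡ (suc m) c f = begin
  Σ< (suc m) (λ k → c * f k)         ≡⟨ Σ<-suc m (λ k → c * f k) ⟩
  c * f 0 + Σ< m (λ k → c * f (suc k)) ≡⟨ cong (λ s → c * f 0 + s) (Σ<-*ˡ m c (f ∘ suc)) ⟩
  c * f 0 + c * Σ< m (f ∘ suc)       ≡⟨ ℚₚ.*-distribˡ-+ c _ _ ⟨
  c * (f 0 + Σ< m (f ∘ suc))         ≡⟨ cong (c *_) (Σ<-suc m f) ⟨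
  c * Σ< (suc m) f                   ∎

shift : (ℕ → ℚ) → ℕ → ℚ
shift f zero    = 0ℚ
shift f (suc k) = f k

Σ<-shift : ∀ m (f : ℕ → ℚ) → Σ< (suc m) (shift f) ≡ Σ< m f
Σ<-shift m f = trans (Σ<-suc m (shift f)) (ℚₚ.+-identityˡ (Σ< m f))

Σ<² : ℕ → ℕ → (ℕ → ℕ → ℚ) → ℚ
Σ<² m n t = Σ< m (λ i → Σ< n (t i))

Σ<²-cong : ∀ m n {s t : ℕ → ℕ → ℚ} → (∀ i j → s i j ≡ t i j) → Σ<² m n s ≡ Σ<² m n t
Σ<²-cong m n s≗t = Σ<-cong m (λ i → Σ<-cong n (s≗t i))

Σ<²-+ : ∀ m n (s t : ℕ → ℕ → ℚ) →
        Σ<² m n (λ i j → s i j + t i j) ≡ Σ<² m n s + Σ<² m n t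
Σ<²-+ m n s t = trans (Σ<-cong m (λ i → Σ<-+ n (s i) (t i))) (Σ<-+ m _ _)

Σ<²-*ˡ : ∀ m n c (t : ℕ → ℕ → ℚ) → Σ<² m n (λ i j → c * t i j) ≡ c * Σ<² m n t
Σ<²-*ˡ m n c t = trans (Σ<-cong m (λ i → Σ<-*ˡ n c (t i))) (Σ<-*ˡ m c _)

Σ<²-+-*ˡ : ∀ m n (s : ℕ → ℕ → ℚ) c t →
           Σ<² m n (λ i j → s i j + c * t i j) ≡ Σ<² m n s + c * Σ<² m n t
Σ<²-+-*ˡ m n s c t =
  trans (Σ<²-+ m n s (λ i j → c * t i j)) (cong (λ σ → Σ<² m n s + σ) (Σ<²-*ˡ m n c t))

Σ<²-linear₃ : ∀ m n a (s : ℕ → ℕ → ℚ) b t c u →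
  Σ<² m n (λ i j → a * s i j + b * t i j + c * u i j)
    ≡ a * Σ<² m n s + b * Σ<² m n t + c * Σ<² m n u
Σ<²-linear₃ m n a s b t c u = begin
  Σ<² m n (λ i j → a * s i j + b * t i j + c * u i j)
    ≡⟨ Σ<²-+-*ˡ m n (λ i j → a * s i j + b * t i j) c u ⟩
  Σ<² m n (λ i j → a * s i j + b * t i j) + c * Σ<² m n u
    ≡⟨ cong (_+ c * Σ<² m n u) (Σ<²-+ m n (λ i j → a * s i j) (λ i j → b * t i j)) ⟩
  Σ<² m n (λ i j → a * s i j) + Σ<² m n (λ i j → b * t i j) + c * Σ<² m n u
    ≡⟨ cong (_+ c * Σ<² m n u) (cong₂ _+_ (Σ<²-*ˡ m n a s) (Σ<²-*ˡ m n b t)) ⟩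
  a * Σ<² m n s + b * Σ<² m n t + c * Σ<² m n u
    ∎

Σ<²-shiftˡ : ∀ m n (t : ℕ → ℕ → ℚ) →
             Σ<² (suc m) n (λ i j → shift (λ i′ → t i′ j) i) ≡ Σ<² m n t
Σ<²-shiftˡ m n t = begin
  Σ<² (suc m) n (λ i j → shift (λ i′ → t i′ j) i)
    ≡⟨ Σ<-suc m (λ i → Σ< n (λ j → shift (λ i′ → t i′ j) i)) ⟩
  Σ< n (λ _ → 0ℚ) + Σ<² m n t
    ≡⟨ cong (_+ Σ<² m n t) (Σ<-zero n _ (λ _ → refl)) ⟩
  0ℚ + Σ<² m n t
    ≡⟨ ℚₚ.+-identityˡ _ ⟩
  Σ<² m n t
    ∎

Σ<²-shiftʳ : ∀ m n (t : ℕ → ℕ → ℚ) → Σ<² m (suc n) (λ i → shift (t i)) ≡ Σ<² m n t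
Σ<²-shiftʳ m n t = Σ<-cong m (λ i → Σ<-shift n (t i))

Σ<²-extend : ∀ d e m (t : ℕ → ℕ → ℚ) → (∀ i j → m < i ℕ.+ j → t i j ≡ 0ℚ) →
             Σ<² (d ℕ.+ suc m) (e ℕ.+ suc m) t ≡ Σ<² (suc m) (suc m) t
Σ<²-extend d e m t t≡0 = begin
  Σ<² (d ℕ.+ suc m) (e ℕ.+ suc m) t
    ≡⟨ Σ<-cong (d ℕ.+ suc m) (λ i → Σ<-extend e (suc m) (t i)
         (λ j m<j → t≡0 i j (ℕₚ.≤-trans m<j (ℕₚ.m≤n+m j i)))) ⟩
  Σ<² (d ℕ.+ suc m) (suc m) t
    ≡⟨ Σ<-extend d (suc m) _ (λ i m<i → Σ<-zero (suc m) (t i)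
         (λ j → t≡0 i j (ℕₚ.≤-trans m<i (ℕₚ.m≤m+n i j)))) ⟩
  Σ<² (suc m) (suc m) t
    ∎

-- Rational arithmetic

positive⇒≢0 : ∀ {p} → Positive p → p ≢ 0ℚ
positive⇒≢0 () refl

*-cancelʳ : ∀ p q c .{{_ : ℚ.NonZero c}} → p * c ≡ q * c → p ≡ q
*-cancelʳ p q c pc≡qc = begin
  p                  ≡⟨ ℚₚ.*-identityʳ p ⟨
  p * 1ℚ             ≡⟨ cong (p *_) (ℚₚ.*-inverseʳ c) ⟨
  p * (c * ℚ.1/ c)   ≡⟨ ℚₚ.*-assoc p c _ ⟨
  p * c * ℚ.1/ c     ≡⟨ cong (_* ℚ.1/ c) pc≡qc ⟩
  q * c * ℚ.1/ c     ≡⟨ ℚₚ.*-assoc q c _ ⟩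
  q * (c * ℚ.1/ c)   ≡⟨ cong (q *_) (ℚₚ.*-inverseʳ c) ⟩
  q * 1ℚ             ≡⟨ ℚₚ.*-identityʳ q ⟩
  q                  ∎

÷₀-*-inverse : ∀ p q → Positive q → p ÷₀ q * q ≡ p
÷₀-*-inverse p q q>0 with q ℚₚ.≟ 0ℚ
... | yes q≡0 = ⊥-elim (positive⇒≢0 q>0 q≡0)
... | no  q≢0 = begin
  p * ℚ.1/ q * q     ≡⟨ ℚₚ.*-assoc p _ q ⟩
  p * (ℚ.1/ q * q)   ≡⟨ cong (p *_) (ℚₚ.*-inverseˡ q) ⟩
  p * 1ℚ             ≡⟨ ℚₚ.*-identityʳ p ⟩
  p                  ∎
  where instance _ = ℚ.≢-nonZero q≢0

÷₀-positive : ∀ p q → Positive p → Positive q → Positive (p ÷₀ q)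
÷₀-positive p q p>0 q>0 with q ℚₚ.≟ 0ℚ
... | yes q≡0 = ⊥-elim (positive⇒≢0 q>0 q≡0)
... | no  _   = ℚₚ.pos*pos⇒pos p {{p>0}} _ {{ℚₚ.1/pos⇒pos q {{q>0}}}}

^2-positive : ∀ p → Positive p → Positive (p ^ 2)
^2-positive p p>0 = ℚₚ.pos*pos⇒pos p {{p>0}} _ {{ℚₚ.pos*pos⇒pos p {{p>0}} 1ℚ}}

*-distribʳ-+₃ : ∀ p q r s → (p + q + r) * s ≡ p * s + q * s + r * s
*-distribʳ-+₃ = solve-∀ ℚ-ring

^2≡* : ∀ p → p ^ 2 ≡ p * p
^2≡* p = cong (p *_) (ℚₚ.*-identityʳ p)

^-2*suc : ∀ p k → p ^ (2 ℕ.* suc k) ≡ p * p * p ^ (2 ℕ.* k)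
^-2*suc p k = trans (cong (p ^_) (ℕₚ.*-suc 2 k)) (sym (ℚₚ.*-assoc p p _))

ι : ℤ → ℚ
ι a = a ℚ./ 1

fromℚᵘ-homo-+ : ∀ p q → ℚ.fromℚᵘ (p ℚᵘ.+ q) ≡ ℚ.fromℚᵘ p + ℚ.fromℚᵘ q
fromℚᵘ-homo-+ p q = ℚₚ.toℚᵘ-injective (ℚᵘₚ.≃-trans (ℚₚ.toℚᵘ-fromℚᵘ _)
  (ℚᵘₚ.≃-trans (ℚᵘₚ.+-cong (ℚᵘₚ.≃-sym (ℚₚ.toℚᵘ-fromℚᵘ p)) (ℚᵘₚ.≃-sym (ℚₚ.toℚᵘ-fromℚᵘ q)))
               (ℚᵘₚ.≃-sym (ℚₚ.toℚᵘ-homo-+ (ℚ.fromℚᵘ p) (ℚ.fromℚᵘ q)))))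

fromℚᵘ-homo-* : ∀ p q → ℚ.fromℚᵘ (p ℚᵘ.* q) ≡ ℚ.fromℚᵘ p * ℚ.fromℚᵘ q
fromℚᵘ-homo-* p q = ℚₚ.toℚᵘ-injective (ℚᵘₚ.≃-trans (ℚₚ.toℚᵘ-fromℚᵘ _)
  (ℚᵘₚ.≃-trans (ℚᵘₚ.*-cong (ℚᵘₚ.≃-sym (ℚₚ.toℚᵘ-fromℚᵘ p)) (ℚᵘₚ.≃-sym (ℚₚ.toℚᵘ-fromℚᵘ q)))
               (ℚᵘₚ.≃-sym (ℚₚ.toℚᵘ-homo-* (ℚ.fromℚᵘ p) (ℚ.fromℚᵘ q)))))

ι-homo-* : ∀ a b → ι (a ℤ.* b) ≡ ι a * ι b
ι-homo-* a b = fromℚᵘ-homo-* (mkℚᵘ a 0) (mkℚᵘ b 0)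

ι-homo-+ : ∀ a b → ι (a ℤ.+ b) ≡ ι a + ι b
ι-homo-+ a b =
  trans (ℚₚ.fromℚᵘ-cong {mkℚᵘ (a ℤ.+ b) 0} {mkℚᵘ a 0 ℚᵘ.+ mkℚᵘ b 0} (*≡* (cross-multiplied a b)))
        (fromℚᵘ-homo-+ (mkℚᵘ a 0) (mkℚᵘ b 0))
  where
  cross-multiplied : ∀ a b → (a ℤ.+ b) ℤ.* 1ℤ ≡ (a ℤ.* 1ℤ ℤ.+ b ℤ.* 1ℤ) ℤ.* 1ℤ
  cross-multiplied = ℤ-Solver.solve-∀

/-*-cancel : ∀ a d .{{_ : ℕ.NonZero d}} → a ℚ./ d * ι (+ d) ≡ ι a
/-*-cancel a (suc d) = trans (sym (fromℚᵘ-homo-* (mkℚᵘ a d) (mkℚᵘ (+ suc d) 0)))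
  (ℚₚ.fromℚᵘ-cong {mkℚᵘ a d ℚᵘ.* mkℚᵘ (+ suc d) 0} {mkℚᵘ a 0} (*≡* (trans (ℤₚ.*-identityʳ _)
    (cong (a ℤ.*_) (cong +_ (sym (ℕₚ.*-identityʳ (suc d))))))))

ι-nonZero : ∀ d .{{_ : ℕ.NonZero d}} → ℚ.NonZero (ι (+ d))
ι-nonZero d = ℚₚ.pos⇒nonZero (ι (+ d)) {{ℚₚ.normalize-pos d 1}}

-- Falling factorials and binomial coefficients

falling-suc : ∀ m k → falling m (suc k) ≡ falling m k ℤ.* (m ℤ.- + k)
falling-suc m zero    = ℤ-Solver.solve (m ∷ [])
falling-suc m (suc k) = begin
  m ℤ.* falling (m ℤ.- + 1) (suc k)
    ≡⟨ cong (m ℤ.*_) (falling-suc (m ℤ.- + 1) k) ⟩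
  m ℤ.* (falling (m ℤ.- + 1) k ℤ.* (m ℤ.- + 1 ℤ.- + k))
    ≡⟨ regroup m (falling (m ℤ.- + 1) k) (+ k) ⟩
  m ℤ.* falling (m ℤ.- + 1) k ℤ.* (m ℤ.- (1ℤ ℤ.+ + k))
    ∎
  where
  regroup : ∀ m f k → m ℤ.* (f ℤ.* (m ℤ.- 1ℤ ℤ.- k)) ≡ m ℤ.* f ℤ.* (m ℤ.- (1ℤ ℤ.+ k))
  regroup = ℤ-Solver.solve-∀

falling-pascal : ∀ m k → falling (ℤ.suc m) (suc k) ≡ falling m (suc k) ℤ.+ falling m k ℤ.* + suc k
falling-pascal m k = begin
  ℤ.suc m ℤ.* falling (ℤ.suc m ℤ.- + 1) k
    ≡⟨ cong (λ m′ → ℤ.suc m ℤ.* falling m′ k) (suc-1 m) ⟩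
  ℤ.suc m ℤ.* falling m k
    ≡⟨ split m (falling m k) (+ k) ⟩
  falling m k ℤ.* (m ℤ.- + k) ℤ.+ falling m k ℤ.* + suc k
    ≡⟨ cong (ℤ._+ falling m k ℤ.* + suc k) (falling-suc m k) ⟨
  falling m (suc k) ℤ.+ falling m k ℤ.* + suc k
    ∎
  where
  suc-1 : ∀ m → 1ℤ ℤ.+ m ℤ.- 1ℤ ≡ m
  suc-1 = ℤ-Solver.solve-∀
  split : ∀ m f k → (1ℤ ℤ.+ m) ℤ.* f ≡ f ℤ.* (m ℤ.- k) ℤ.+ f ℤ.* (1ℤ ℤ.+ k)
  split = ℤ-Solver.solve-∀

falling-vanishes : ∀ m k → m < k → falling (+ m) k ≡ + 0
falling-vanishes zero    (suc k) _         = refl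
falling-vanishes (suc m) (suc k) (ℕ.s≤s m<k) =
  trans (cong (+ suc m ℤ.*_) (falling-vanishes m k m<k)) (ℤₚ.*-zeroʳ (+ suc m))

binom-*-! : ∀ m k → binom m (+ k) * ι (+ (k !)) ≡ ι (falling m k)
binom-*-! m k = /-*-cancel (falling m k) (k !) {{k ℕₚ.!≢0}}

binom-vanishes : ∀ m k → m < k → binom (+ m) (+ k) ≡ 0ℚ
binom-vanishes m k m<k = trans (cong (λ a → (a ℚ./ (k !)) {{k ℕₚ.!≢0}}) (falling-vanishes m k m<k))
                               (ℚₚ.0/n≡0 (k !) {{k ℕₚ.!≢0}})

binom-pascal : ∀ m k → binom (ℤ.suc m) (ℤ.suc k) ≡ binom m (ℤ.suc k) + binom m k
binom-pascal m -[1+ zero  ] = refl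
binom-pascal m -[1+ suc k ] = refl
binom-pascal m (+ k) =
  *-cancelʳ _ _ (ι (+ (suc k !))) {{ι-nonZero (suc k !) {{suc k ℕₚ.!≢0}}}} (begin
  binom (ℤ.suc m) (+ suc k) * ι (+ (suc k !))
    ≡⟨ binom-*-! (ℤ.suc m) (suc k) ⟩
  ι (falling (ℤ.suc m) (suc k))
    ≡⟨ cong ι (falling-pascal m k) ⟩
  ι (fₖ₊₁ ℤ.+ fₖ ℤ.* + suc k)
    ≡⟨ trans (ι-homo-+ fₖ₊₁ (fₖ ℤ.* + suc k)) (cong (λ s → ι fₖ₊₁ + s) (ι-homo-* fₖ (+ suc k))) ⟩
  ι fₖ₊₁ + ι fₖ * ι (+ suc k)
    ≡⟨ cong₂ (λ a b → a + b * ι (+ suc k)) (binom-*-! m (suc k)) (binom-*-! m k) ⟨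
  bₖ₊₁ * ι (+ (suc k !)) + bₖ * ι (+ (k !)) * ι (+ suc k)
    ≡⟨ cong (λ s → bₖ₊₁ * ι (+ (suc k !)) + s) (ℚₚ.*-assoc bₖ _ _) ⟩
  bₖ₊₁ * ι (+ (suc k !)) + bₖ * (ι (+ (k !)) * ι (+ suc k))
    ≡⟨ cong (λ a → bₖ₊₁ * ι (+ (suc k !)) + bₖ * a) k!*[k+1] ⟩
  bₖ₊₁ * ι (+ (suc k !)) + bₖ * ι (+ (suc k !))
    ≡⟨ ℚₚ.*-distribʳ-+ (ι (+ (suc k !))) bₖ₊₁ bₖ ⟨
  (bₖ₊₁ + bₖ) * ι (+ (suc k !))
    ∎)
  where
  fₖ₊₁ = falling m (suc k)
  fₖ   = falling m k
  bₖ₊₁ = binom m (+ suc k)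
  bₖ   = binom m (+ k)
  k!*[k+1] : ι (+ (k !)) * ι (+ suc k) ≡ ι (+ (suc k !))
  k!*[k+1] = begin
    ι (+ (k !)) * ι (+ suc k)    ≡⟨ ι-homo-* (+ (k !)) (+ suc k) ⟨
    ι (+ (k !) ℤ.* + suc k)      ≡⟨ cong ι (ℤₚ.pos-* (k !) (suc k)) ⟨
    ι (+ (k ! ℕ.* suc k))        ≡⟨ cong (ι ∘ +_) (ℕₚ.*-comm (k !) (suc k)) ⟩
    ι (+ (suc k !))              ∎

binom²-cong : ∀ {N N′ K K′ C C′ J J′} → N ≡ N′ → K ≡ K′ → C ≡ C′ → J ≡ J′ →
              binom N K * binom C J ≡ binom N′ K′ * binom C′ J′
binom²-cong refl refl refl refl = refl

pascal-square : ∀ N K C J →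
  binom (ℤ.suc N) (ℤ.suc K) * binom (ℤ.suc C) (ℤ.suc J) + binom N K * binom C J
    ≡ binom N (ℤ.suc K) * binom C (ℤ.suc J) + binom (ℤ.suc N) (ℤ.suc K) * binom C J
      + binom N K * binom (ℤ.suc C) (ℤ.suc J)
pascal-square N K C J = begin
  binom (ℤ.suc N) (ℤ.suc K) * binom (ℤ.suc C) (ℤ.suc J) + b * d
    ≡⟨ cong₂ (λ u v → u * v + b * d) (binom-pascal N K) (binom-pascal C J) ⟩
  (a + b) * (c + d) + b * d
    ≡⟨ expand a b c d ⟩
  a * c + (a + b) * d + b * (c + d)
    ≡⟨ cong₂ (λ u v → a * c + u * d + b * v) (binom-pascal N K) (binom-pascal C J) ⟨
  a * c + binom (ℤ.suc N) (ℤ.suc K) * d + b * binom (ℤ.suc C) (ℤ.suc J)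
    ∎
  where
  a = binom N (ℤ.suc K)
  b = binom N K
  c = binom C (ℤ.suc J)
  d = binom C J
  expand : ∀ a b c d → (a + b) * (c + d) + b * d ≡ a * c + (a + b) * d + b * (c + d)
  expand = solve-∀ ℚ-ring

-- Three-term recurrences

exchange⇒linear : ∀ (a : ℕ → ℚ) c p q → (∀ k → ℚ.NonZero (a k)) →
  (∀ k → a (suc (suc k)) * a k ≡ a (suc k) * a (suc k) + c) →
  p * (a 2 + a 0) ≡ q * a 1 →
  ∀ k → p * (a (suc (suc k)) + a k) ≡ q * a (suc k)
exchange⇒linear a c p q _   _        base zero    = base
exchange⇒linear a c p q a≢0 exchange base (suc k) =
  *-cancelʳ _ _ a₁ {{a≢0 (suc k)}} (begin
    p * (a₃ + a₁) * a₁       ≡⟨ ℚₚ.*-assoc p _ a₁ ⟩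
    p * ((a₃ + a₁) * a₁)     ≡⟨ cong (p *_) (ℚₚ.*-comm (a₃ + a₁) a₁) ⟩
    p * (a₁ * (a₃ + a₁))     ≡⟨ cong (p *_) cross ⟩
    p * (a₂ * (a₂ + a₀))     ≡⟨ x∙yz≈y∙xz p a₂ _ ⟩
    a₂ * (p * (a₂ + a₀))     ≡⟨ cong (a₂ *_) (exchange⇒linear a c p q a≢0 exchange base k) ⟩
    a₂ * (q * a₁)            ≡⟨ x∙yz≈y∙xz a₂ q a₁ ⟩
    q * (a₂ * a₁)            ≡⟨ ℚₚ.*-assoc q a₂ a₁ ⟨
    q * a₂ * a₁              ∎)
  where
  a₀ = a k
  a₁ = a (suc k)
  a₂ = a (suc (suc k))
  a₃ = a (suc (suc (suc k)))
  cross : a₁ * (a₃ + a₁) ≡ a₂ * (a₂ + a₀)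
  cross = begin
    a₁ * (a₃ + a₁)           ≡⟨ ℚₚ.*-distribˡ-+ a₁ a₃ a₁ ⟩
    a₁ * a₃ + a₁ * a₁        ≡⟨ cong (_+ a₁ * a₁) (ℚₚ.*-comm a₁ a₃) ⟩
    a₃ * a₁ + a₁ * a₁        ≡⟨ cong (_+ a₁ * a₁) (exchange (suc k)) ⟩
    a₂ * a₂ + c + a₁ * a₁    ≡⟨ ℚₚ.+-assoc (a₂ * a₂) c _ ⟩
    a₂ * a₂ + (c + a₁ * a₁)  ≡⟨ cong (λ s → a₂ * a₂ + s) (ℚₚ.+-comm c (a₁ * a₁)) ⟩
    a₂ * a₂ + (a₁ * a₁ + c)  ≡⟨ cong (λ s → a₂ * a₂ + s) (exchange k) ⟨
    a₂ * a₂ + a₂ * a₀        ≡⟨ ℚₚ.*-distribˡ-+ a₂ a₂ a₀ ⟨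
    a₂ * (a₂ + a₀)           ∎

recurrence-unique : ∀ (a b : ℚ) (f g : ℕ → ℚ) →
  (∀ n → f (suc (suc n)) + b * f n ≡ a * f (suc n)) →
  (∀ n → g (suc (suc n)) + b * g n ≡ a * g (suc n)) →
  f 0 ≡ g 0 → f 1 ≡ g 1 → ∀ n → f n ≡ g n
recurrence-unique a b f g f-rec g-rec f₀≡g₀ f₁≡g₁ n = proj₁ (consecutive n)
  where
  consecutive : ∀ n → f n ≡ g n × f (suc n) ≡ g (suc n)
  consecutive zero    = f₀≡g₀ , f₁≡g₁
  consecutive (suc n) with consecutive n
  ... | fₙ≡gₙ , fₙ₊₁≡gₙ₊₁ = fₙ₊₁≡gₙ₊₁ , ∙-cancelʳ (b * g n) _ _ (begin
    f (suc (suc n)) + b * g n   ≡⟨ cong (λ s → f (suc (suc n)) + b * s) fₙ≡gₙ ⟨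
    f (suc (suc n)) + b * f n   ≡⟨ f-rec n ⟩
    a * f (suc n)               ≡⟨ cong (a *_) fₙ₊₁≡gₙ₊₁ ⟩
    a * g (suc n)               ≡⟨ g-rec n ⟨
    g (suc (suc n)) + b * g n   ∎)

-- The coefficients A

-- A n i j is Aℤ (+ n) (+ i) (+ j) by definition; integer indices let the recurrence shift i and
-- j below 0, where the binomial conventions make the shifted coefficients vanish.
Aℤ : ℤ → ℤ → ℤ → ℚ
Aℤ n i j = binom (n ℤ.- j) (ℤ.suc n ℤ.- i ℤ.- j) * binom (i ℤ.+ j) j

Aℤ-rec : ∀ n i j →
  Aℤ (1ℤ ℤ.+ (1ℤ ℤ.+ n)) i j + Aℤ n i (j ℤ.- 1ℤ)
    ≡ Aℤ (1ℤ ℤ.+ n) (i ℤ.- 1ℤ) j + Aℤ (1ℤ ℤ.+ n) i (j ℤ.- 1ℤ) + Aℤ (1ℤ ℤ.+ n) i j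
Aℤ-rec n i j = begin
  Aℤ (1ℤ ℤ.+ (1ℤ ℤ.+ n)) i j + Aℤ n i (j ℤ.- 1ℤ)
    ≡⟨ cong₂ _+_ (binom²-cong e₁ e₂ e₃ e₄) (binom²-cong e₅ e₆ (refl {x = C}) (refl {x = J})) ⟩
  binom (ℤ.suc N) (ℤ.suc K) * binom (ℤ.suc C) (ℤ.suc J) + binom N K * binom C J
    ≡⟨ pascal-square N K C J ⟩
  binom N (ℤ.suc K) * binom C (ℤ.suc J) + binom (ℤ.suc N) (ℤ.suc K) * binom C J
    + binom N K * binom (ℤ.suc C) (ℤ.suc J)
    ≡⟨ cong₂ _+_ (cong₂ _+_ (binom²-cong (refl {x = N}) e₇ e₈ e₄)
                            (binom²-cong e₉ e₁₀ (refl {x = C}) (refl {x = J})))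
                 (binom²-cong (refl {x = N}) (refl {x = K}) e₃ e₄) ⟨
  Aℤ (1ℤ ℤ.+ n) (i ℤ.- 1ℤ) j + Aℤ (1ℤ ℤ.+ n) i (j ℤ.- 1ℤ) + Aℤ (1ℤ ℤ.+ n) i j
    ∎
  where
  -- N, K, C, J make the five coefficients the five products in pascal-square; e₁ … e₁₀ match
  -- their arguments.
  N = 1ℤ ℤ.+ n ℤ.- j
  K = 1ℤ ℤ.+ (1ℤ ℤ.+ n) ℤ.- i ℤ.- j
  C = i ℤ.+ (j ℤ.- 1ℤ)
  J = j ℤ.- 1ℤ
  e₁ : 1ℤ ℤ.+ (1ℤ ℤ.+ n) ℤ.- j ≡ 1ℤ ℤ.+ (1ℤ ℤ.+ n ℤ.- j)
  e₁ = ℤ-Solver.solve (n ∷ j ∷ [])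
  e₂ : 1ℤ ℤ.+ (1ℤ ℤ.+ (1ℤ ℤ.+ n)) ℤ.- i ℤ.- j ≡ 1ℤ ℤ.+ (1ℤ ℤ.+ (1ℤ ℤ.+ n) ℤ.- i ℤ.- j)
  e₂ = ℤ-Solver.solve (n ∷ i ∷ j ∷ [])
  e₃ : i ℤ.+ j ≡ 1ℤ ℤ.+ (i ℤ.+ (j ℤ.- 1ℤ))
  e₃ = ℤ-Solver.solve (i ∷ j ∷ [])
  e₄ : j ≡ 1ℤ ℤ.+ (j ℤ.- 1ℤ)
  e₄ = ℤ-Solver.solve (j ∷ [])
  e₅ : n ℤ.- (j ℤ.- 1ℤ) ≡ 1ℤ ℤ.+ n ℤ.- j
  e₅ = ℤ-Solver.solve (n ∷ j ∷ [])
  e₆ : 1ℤ ℤ.+ n ℤ.- i ℤ.- (j ℤ.- 1ℤ) ≡ 1ℤ ℤ.+ (1ℤ ℤ.+ n) ℤ.- i ℤ.- j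
  e₆ = ℤ-Solver.solve (n ∷ i ∷ j ∷ [])
  e₇ : 1ℤ ℤ.+ (1ℤ ℤ.+ n) ℤ.- (i ℤ.- 1ℤ) ℤ.- j ≡ 1ℤ ℤ.+ (1ℤ ℤ.+ (1ℤ ℤ.+ n) ℤ.- i ℤ.- j)
  e₇ = ℤ-Solver.solve (n ∷ i ∷ j ∷ [])
  e₈ : i ℤ.- 1ℤ ℤ.+ j ≡ i ℤ.+ (j ℤ.- 1ℤ)
  e₈ = ℤ-Solver.solve (i ∷ j ∷ [])
  e₉ : 1ℤ ℤ.+ n ℤ.- (j ℤ.- 1ℤ) ≡ 1ℤ ℤ.+ (1ℤ ℤ.+ n ℤ.- j)
  e₉ = ℤ-Solver.solve (n ∷ j ∷ [])
  e₁₀ : 1ℤ ℤ.+ (1ℤ ℤ.+ n) ℤ.- i ℤ.- (j ℤ.- 1ℤ) ≡ 1ℤ ℤ.+ (1ℤ ℤ.+ (1ℤ ℤ.+ n) ℤ.- i ℤ.- j)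
  e₁₀ = ℤ-Solver.solve (n ∷ i ∷ j ∷ [])

Aˣ Aʸ : ℕ → ℕ → ℕ → ℚ
Aˣ n i j = Aℤ (+ n) (+ i ℤ.- 1ℤ) (+ j)
Aʸ n i j = Aℤ (+ n) (+ i) (+ j ℤ.- 1ℤ)

A-vanishes : ∀ n i j → suc n < i ℕ.+ j → A n i j ≡ 0ℚ
A-vanishes n i j n+1<i+j with ℕₚ.m≤n⇒∃[o]m+o≡n n+1<i+j
... | o , n+2+o≡i+j =
  trans (cong (λ k → binom (+ n ℤ.- + j) k * binom (+ (i ℕ.+ j)) (+ j)) negative)
        (ℚₚ.*-zeroˡ (binom (+ (i ℕ.+ j)) (+ j)))
  where
  sub-sub : ∀ a b c → a ℤ.- b ℤ.- c ≡ a ℤ.- (b ℤ.+ c)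
  sub-sub = ℤ-Solver.solve-∀
  sub-add : ∀ a b → a ℤ.- (a ℤ.+ b) ≡ ℤ.- b
  sub-add = ℤ-Solver.solve-∀
  negative : + suc n ℤ.- + i ℤ.- + j ≡ -[1+ o ]
  negative = begin
    + suc n ℤ.- + i ℤ.- + j             ≡⟨ sub-sub (+ suc n) (+ i) (+ j) ⟩
    + suc n ℤ.- + (i ℕ.+ j)             ≡⟨ cong (λ m → + suc n ℤ.- + m)
                                              (trans (ℕₚ.+-suc (suc n) o) n+2+o≡i+j) ⟨
    + suc n ℤ.- (+ suc n ℤ.+ + suc o)   ≡⟨ sub-add (+ suc n) (+ suc o) ⟩
    -[1+ o ]                            ∎

-- At j = 0 the first factor binom n (n + 2) vanishes (the second is binom (-1) 0 = 1);
-- otherwise the second factor binom j (j + 1) does.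
Aˣ-at-0 : ∀ n j → Aˣ n 0 j ≡ 0ℚ
Aˣ-at-0 n zero    = trans (cong (_* 1ℚ) (binom-vanishes (n ℕ.+ 0) (suc n ℕ.+ 1 ℕ.+ 0) n<n+2))
                          (ℚₚ.*-zeroˡ 1ℚ)
  where
  n<n+2 : n ℕ.+ 0 < suc n ℕ.+ 1 ℕ.+ 0
  n<n+2 = ℕₚ.+-monoˡ-< 0 (ℕₚ.m≤m+n (suc n) 1)
Aˣ-at-0 n (suc j) = trans (cong (b *_) (binom-vanishes j (suc j) ℕₚ.≤-refl)) (ℚₚ.*-zeroʳ b)
  where
  b = binom (+ n ℤ.- + suc j) (+ suc n ℤ.- -[1+ 0 ] ℤ.- + suc j)

Aʸ-at-0 : ∀ n i → Aʸ n i 0 ≡ 0ℚ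
Aʸ-at-0 n i = ℚₚ.*-zeroʳ (binom (+ n ℤ.- -[1+ 0 ]) (+ suc n ℤ.- + i ℤ.- -[1+ 0 ]))

Aʸ-vanishes : ∀ n i j → suc (suc n) < i ℕ.+ j → Aʸ n i j ≡ 0ℚ
Aʸ-vanishes n i zero    _         = Aʸ-at-0 n i
Aʸ-vanishes n i (suc j) n+2<i+j+1 =
  A-vanishes n i j (ℕ.s≤s⁻¹ (ℕₚ.≤-trans n+2<i+j+1 (ℕₚ.≤-reflexive (ℕₚ.+-suc i j))))

-- The expansion and its recurrence

module Expansion (x y z : ℚ) where

  monomial : ℕ → ℕ → ℕ → ℚ
  monomial d i j = x ^ (2 ℕ.* i) * y ^ (2 ℕ.* j) * z ^ (2 ℕ.* (d ∸ (i ℕ.+ j)))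

  term : ℕ → ℕ → ℕ → ℚ
  term n i j = A n i j * x ^ (2 ℕ.* i) * y ^ (2 ℕ.* j) * z ^ (2 ℕ.* (suc n ∸ i ∸ j))

  F : ℕ → ℚ
  F n = Σ<² (suc (suc n)) (suc (suc n)) (term n)

  term≡A*monomial : ∀ n i j → term n i j ≡ A n i j * monomial (suc n) i j
  term≡A*monomial n i j = begin
    A n i j * x ^ (2 ℕ.* i) * y ^ (2 ℕ.* j) * z ^ (2 ℕ.* (suc n ∸ i ∸ j))
      ≡⟨ cong (λ e → A n i j * x ^ (2 ℕ.* i) * y ^ (2 ℕ.* j) * z ^ (2 ℕ.* e))
              (ℕₚ.∸-+-assoc (suc n) i j) ⟩
    A n i j * x ^ (2 ℕ.* i) * y ^ (2 ℕ.* j) * z ^ (2 ℕ.* (suc n ∸ (i ℕ.+ j)))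
      ≡⟨ regroup (A n i j) _ _ _ ⟩
    A n i j * monomial (suc n) i j
      ∎
    where
    regroup : ∀ a p q r → a * p * q * r ≡ a * (p * q * r)
    regroup = solve-∀ ℚ-ring

  term-vanishes : ∀ n i j → suc n < i ℕ.+ j → term n i j ≡ 0ℚ
  term-vanishes n i j n+1<i+j = begin
    term n i j                        ≡⟨ term≡A*monomial n i j ⟩
    A n i j * monomial (suc n) i j    ≡⟨ cong (_* monomial (suc n) i j) (A-vanishes n i j n+1<i+j) ⟩
    0ℚ * monomial (suc n) i j         ≡⟨ ℚₚ.*-zeroˡ (monomial (suc n) i j) ⟩
    0ℚ                                ∎

  monomial-x : ∀ d i j → x * x * monomial d i j ≡ monomial (suc d) (suc i) j
  monomial-x d i j = begin
    x * x * (xⁱ * yʲ * zᵏ)       ≡⟨ regroup (x * x) xⁱ yʲ zᵏ ⟩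
    x * x * xⁱ * yʲ * zᵏ         ≡⟨ cong (λ p → p * yʲ * zᵏ) (^-2*suc x i) ⟨
    monomial (suc d) (suc i) j   ∎
    where
    xⁱ = x ^ (2 ℕ.* i)
    yʲ = y ^ (2 ℕ.* j)
    zᵏ = z ^ (2 ℕ.* (d ∸ (i ℕ.+ j)))
    regroup : ∀ a p q r → a * (p * q * r) ≡ a * p * q * r
    regroup = solve-∀ ℚ-ring

  monomial-y : ∀ d i j → y * y * monomial d i j ≡ monomial (suc d) i (suc j)
  monomial-y d i j = begin
    y * y * (xⁱ * yʲ * zᵏ)                             ≡⟨ regroup (y * y) xⁱ yʲ zᵏ ⟩
    xⁱ * (y * y * yʲ) * z ^ (2 ℕ.* (suc d ∸ suc (i ℕ.+ j)))
      ≡⟨ cong₂ (λ p e → xⁱ * p * z ^ (2 ℕ.* (suc d ∸ e))) (^-2*suc y j) (ℕₚ.+-suc i j) ⟨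
    monomial (suc d) i (suc j)                         ∎
    where
    xⁱ = x ^ (2 ℕ.* i)
    yʲ = y ^ (2 ℕ.* j)
    zᵏ = z ^ (2 ℕ.* (d ∸ (i ℕ.+ j)))
    regroup : ∀ a p q r → a * (p * q * r) ≡ p * (a * q) * r
    regroup = solve-∀ ℚ-ring

  monomial-z : ∀ d i j → i ℕ.+ j ≤ d → z * z * monomial d i j ≡ monomial (suc d) i j
  monomial-z d i j i+j≤d = begin
    z * z * (xⁱ * yʲ * zᵏ)                        ≡⟨ regroup (z * z) xⁱ yʲ zᵏ ⟩
    xⁱ * yʲ * (z * z * zᵏ)                        ≡⟨ cong (xⁱ * yʲ *_) (^-2*suc z (d ∸ (i ℕ.+ j))) ⟨
    xⁱ * yʲ * z ^ (2 ℕ.* suc (d ∸ (i ℕ.+ j)))     ≡⟨ cong (λ e → xⁱ * yʲ * z ^ (2 ℕ.* e))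
                                                          (ℕₚ.+-∸-assoc 1 i+j≤d) ⟨
    monomial (suc d) i j                          ∎
    where
    xⁱ = x ^ (2 ℕ.* i)
    yʲ = y ^ (2 ℕ.* j)
    zᵏ = z ^ (2 ℕ.* (d ∸ (i ℕ.+ j)))
    regroup : ∀ a p q r → a * (p * q * r) ≡ p * q * (a * r)
    regroup = solve-∀ ℚ-ring

  -- For d < i + j the exponent d ∸ (i + j) is truncated to 0, so there c has to vanish.
  lift-z : ∀ c d i j → (d < i ℕ.+ j → c ≡ 0ℚ) →
           z * z * (c * monomial d i j) ≡ c * monomial (suc d) i j
  lift-z c d i j c≡0 with i ℕ.+ j ℕₚ.≤? d
  ... | yes i+j≤d = trans (x∙yz≈y∙xz (z * z) c _) (cong (c *_) (monomial-z d i j i+j≤d))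
  ... | no  i+j≰d with c≡0 (ℕₚ.≰⇒> i+j≰d)
  ...   | refl = begin
    z * z * (0ℚ * monomial d i j)   ≡⟨ cong (z * z *_) (ℚₚ.*-zeroˡ (monomial d i j)) ⟩
    z * z * 0ℚ                      ≡⟨ ℚₚ.*-zeroʳ (z * z) ⟩
    0ℚ                              ≡⟨ ℚₚ.*-zeroˡ (monomial (suc d) i j) ⟨
    0ℚ * monomial (suc d) i j       ∎

  lift-x : ∀ n i j → x * x * shift (λ i′ → term n i′ j) i ≡ Aˣ n i j * monomial (suc (suc n)) i j
  lift-x n zero    j = begin
    x * x * 0ℚ     ≡⟨ ℚₚ.*-zeroʳ (x * x) ⟩
    0ℚ             ≡⟨ ℚₚ.*-zeroˡ m ⟨
    0ℚ * m         ≡⟨ cong (_* m) (Aˣ-at-0 n j) ⟨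
    Aˣ n 0 j * m   ∎
    where m = monomial (suc (suc n)) 0 j
  lift-x n (suc i) j = begin
    x * x * term n i j                         ≡⟨ cong (x * x *_) (term≡A*monomial n i j) ⟩
    x * x * (A n i j * monomial (suc n) i j)   ≡⟨ x∙yz≈y∙xz (x * x) (A n i j) _ ⟩
    A n i j * (x * x * monomial (suc n) i j)   ≡⟨ cong (A n i j *_) (monomial-x (suc n) i j) ⟩
    A n i j * monomial (suc (suc n)) (suc i) j ∎

  lift-y : ∀ n i j → y * y * shift (term n i) j ≡ Aʸ n i j * monomial (suc (suc n)) i j
  lift-y n i zero    = begin
    y * y * 0ℚ     ≡⟨ ℚₚ.*-zeroʳ (y * y) ⟩
    0ℚ             ≡⟨ ℚₚ.*-zeroˡ m ⟨
    0ℚ * m         ≡⟨ cong (_* m) (Aʸ-at-0 n i) ⟨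
    Aʸ n i 0 * m   ∎
    where m = monomial (suc (suc n)) i 0
  lift-y n i (suc j) = begin
    y * y * term n i j                         ≡⟨ cong (y * y *_) (term≡A*monomial n i j) ⟩
    y * y * (A n i j * monomial (suc n) i j)   ≡⟨ x∙yz≈y∙xz (y * y) (A n i j) _ ⟩
    A n i j * (y * y * monomial (suc n) i j)   ≡⟨ cong (A n i j *_) (monomial-y (suc n) i j) ⟩
    A n i j * monomial (suc (suc n)) i (suc j) ∎

  term-rec : ∀ n i j →
    term (suc (suc n)) i j + y * y * (z * z) * shift (term n i) j
      ≡ x * x * shift (λ i′ → term (suc n) i′ j) i + y * y * shift (term (suc n) i) j
        + z * z * term (suc n) i j
  term-rec n i j = begin
    term (suc (suc n)) i j + y * y * (z * z) * shift (term n i) j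
      ≡⟨ cong₂ _+_ (term≡A*monomial (suc (suc n)) i j) lift-yz ⟩
    A (suc (suc n)) i j * m + Aʸ n i j * m
      ≡⟨ ℚₚ.*-distribʳ-+ m (A (suc (suc n)) i j) (Aʸ n i j) ⟨
    (A (suc (suc n)) i j + Aʸ n i j) * m
      ≡⟨ cong (_* m) (Aℤ-rec (+ n) (+ i) (+ j)) ⟩
    (aˣ + aʸ + a) * m
      ≡⟨ *-distribʳ-+₃ aˣ aʸ a m ⟩
    aˣ * m + aʸ * m + a * m
      ≡⟨ cong₂ _+_ (cong₂ _+_ (lift-x (suc n) i j) (lift-y (suc n) i j)) lift-z′ ⟨
    x * x * shift (λ i′ → term (suc n) i′ j) i + y * y * shift (term (suc n) i) j
      + z * z * term (suc n) i j
      ∎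
    where
    m  = monomial (suc (suc (suc n))) i j
    aˣ = Aˣ (suc n) i j
    aʸ = Aʸ (suc n) i j
    a  = A (suc n) i j
    swap : ∀ p q r → p * q * r ≡ q * (p * r)
    swap = solve-∀ ℚ-ring
    lift-yz : y * y * (z * z) * shift (term n i) j ≡ Aʸ n i j * m
    lift-yz = begin
      y * y * (z * z) * shift (term n i) j              ≡⟨ swap (y * y) (z * z) _ ⟩
      z * z * (y * y * shift (term n i) j)              ≡⟨ cong (z * z *_) (lift-y n i j) ⟩
      z * z * (Aʸ n i j * monomial (suc (suc n)) i j)   ≡⟨ lift-z (Aʸ n i j) (suc (suc n)) i j
                                                                  (Aʸ-vanishes n i j) ⟩
      Aʸ n i j * m                                      ∎
    lift-z′ : z * z * term (suc n) i j ≡ a * m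
    lift-z′ = trans (cong (z * z *_) (term≡A*monomial (suc n) i j))
                    (lift-z a (suc (suc n)) i j (A-vanishes (suc n) i j))

  F-box : ∀ d e n → Σ<² (d ℕ.+ suc (suc n)) (e ℕ.+ suc (suc n)) (term n) ≡ F n
  F-box d e n = Σ<²-extend d e (suc n) (term n) (term-vanishes n)

  F-rec : ∀ n → F (suc (suc n)) + y * y * (z * z) * F n ≡ (x * x + y * y + z * z) * F (suc n)
  F-rec n = begin
    F (suc (suc n)) + y * y * (z * z) * F n
      ≡⟨ cong (λ s → F (suc (suc n)) + y * y * (z * z) * s) shifted⁰ ⟨
    Σ<² B B (term (suc (suc n))) + y * y * (z * z) * Σ<² B B t⁰
      ≡⟨ Σ<²-+-*ˡ B B (term (suc (suc n))) (y * y * (z * z)) t⁰ ⟨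
    Σ<² B B (λ i j → term (suc (suc n)) i j + y * y * (z * z) * t⁰ i j)
      ≡⟨ Σ<²-cong B B (term-rec n) ⟩
    Σ<² B B (λ i j → x * x * tˣ i j + y * y * tʸ i j + z * z * term (suc n) i j)
      ≡⟨ Σ<²-linear₃ B B (x * x) tˣ (y * y) tʸ (z * z) (term (suc n)) ⟩
    x * x * Σ<² B B tˣ + y * y * Σ<² B B tʸ + z * z * Σ<² B B (term (suc n))
      ≡⟨ cong₂ _+_ (cong₂ _+_ (cong (x * x *_) shiftedˣ) (cong (y * y *_) shiftedʸ))
                   (cong (z * z *_) (F-box 1 1 (suc n))) ⟩
    x * x * F (suc n) + y * y * F (suc n) + z * z * F (suc n)
      ≡⟨ *-distribʳ-+₃ (x * x) (y * y) (z * z) (F (suc n)) ⟨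
    (x * x + y * y + z * z) * F (suc n)
      ∎
    where
    B = suc (suc (suc (suc n)))
    tˣ tʸ t⁰ : ℕ → ℕ → ℚ
    tˣ i j = shift (λ i′ → term (suc n) i′ j) i
    tʸ i j = shift (term (suc n) i) j
    t⁰ i j = shift (term n i) j
    shiftedˣ : Σ<² B B tˣ ≡ F (suc n)
    shiftedˣ = trans (Σ<²-shiftˡ (suc (suc (suc n))) B (term (suc n))) (F-box 0 1 (suc n))
    shiftedʸ : Σ<² B B tʸ ≡ F (suc n)
    shiftedʸ = trans (Σ<²-shiftʳ B (suc (suc (suc n))) (term (suc n))) (F-box 1 0 (suc n))
    shifted⁰ : Σ<² B B t⁰ ≡ F n
    shifted⁰ = trans (Σ<²-shiftʳ B (suc (suc (suc n))) (term n)) (F-box 2 1 n)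

  -- The left-hand sides of unfolded are F 0 and F 1 with the coefficients A n i j evaluated.
  F₀ : F 0 ≡ x * x + y * y
  F₀ = unfolded x y z
    where
    unfolded : ∀ x y z →
      0ℚ * 1ℚ * 1ℚ * (z * (z * 1ℚ)) + (1ℚ * 1ℚ * (y * (y * 1ℚ)) * 1ℚ + 0ℚ)
        + (1ℚ * (x * (x * 1ℚ)) * 1ℚ * 1ℚ + (0ℚ * (x * (x * 1ℚ)) * (y * (y * 1ℚ)) * 1ℚ + 0ℚ) + 0ℚ)
        ≡ x * x + y * y
    unfolded = solve-∀ ℚ-ring

  F₁ : F 1 ≡ (x * x + y * y) * (x * x + y * y) + z * z * (x * x)
  F₁ = unfolded x y z
    where
    unfolded : ∀ x y z →
      0ℚ * 1ℚ * 1ℚ * (z * (z * (z * (z * 1ℚ))))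
        + (0ℚ * 1ℚ * (y * (y * 1ℚ)) * (z * (z * 1ℚ))
           + (1ℚ * 1ℚ * (y * (y * (y * (y * 1ℚ)))) * 1ℚ + 0ℚ))
        + (1ℚ * (x * (x * 1ℚ)) * 1ℚ * (z * (z * 1ℚ))
           + ((1ℚ + 1ℚ) * (x * (x * 1ℚ)) * (y * (y * 1ℚ)) * 1ℚ
              + (0ℚ * (x * (x * 1ℚ)) * (y * (y * (y * (y * 1ℚ)))) * 1ℚ + 0ℚ))
           + (1ℚ * (x * (x * (x * (x * 1ℚ)))) * 1ℚ * 1ℚ
              + (0ℚ * (x * (x * (x * (x * 1ℚ)))) * (y * (y * 1ℚ)) * 1ℚ
                 + (0ℚ * (x * (x * (x * (x * 1ℚ)))) * (y * (y * (y * (y * 1ℚ)))) * 1ℚ + 0ℚ))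
              + 0ℚ))
        ≡ (x * x + y * y) * (x * x + y * y) + z * z * (x * x)
    unfolded = solve-∀ ℚ-ring

-- The Markov polynomials M_{1/k} and their recurrence

module Markov (x y z : ℚ) (x>0 : Positive x) (y>0 : Positive y) (z>0 : Positive z) where

  M : ℕ → ℚ
  M k = M₁/ k x y z

  M-positive : ∀ k → Positive (M k)
  M-positive k = proj₁ (consecutive k)
    where
    sum-of-squares : ∀ p q → Positive p → Positive q → Positive (p ^ 2 + q ^ 2)
    sum-of-squares p q p>0 q>0 =
      ℚₚ.pos+pos⇒pos (p ^ 2) {{^2-positive p p>0}} (q ^ 2) {{^2-positive q q>0}}
    consecutive : ∀ k → Positive (M k) × Positive (M (suc k))
    consecutive zero    = y>0 , ÷₀-positive _ z (sum-of-squares x y x>0 y>0) z>0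
    consecutive (suc k) with consecutive k
    ... | Mₖ>0 , Mₖ₊₁>0 =
      Mₖ₊₁>0 , ÷₀-positive _ (M k) (sum-of-squares (M (suc k)) x Mₖ₊₁>0 x>0) Mₖ>0

  M-exchange : ∀ k → M (suc (suc k)) * M k ≡ M (suc k) * M (suc k) + x * x
  M-exchange k = trans (÷₀-*-inverse _ (M k) (M-positive k)) (cong₂ _+_ (^2≡* (M (suc k))) (^2≡* x))

  M₁*z : M 1 * z ≡ x * x + y * y
  M₁*z = trans (÷₀-*-inverse _ z z>0) (cong₂ _+_ (^2≡* x) (^2≡* y))

  M-linear : ∀ k → y * z * (M (suc (suc k)) + M k) ≡ (x * x + y * y + z * z) * M (suc k)
  M-linear = exchange⇒linear M (x * x) (y * z) (x * x + y * y + z * z)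
    (λ k → ℚₚ.pos⇒nonZero (M k) {{M-positive k}}) M-exchange
    (base (M 1) (M 2) (M-exchange 0) M₁*z)
    where
    base : ∀ m₁ m₂ → m₂ * y ≡ m₁ * m₁ + x * x → m₁ * z ≡ x * x + y * y →
           y * z * (m₂ + y) ≡ (x * x + y * y + z * z) * m₁
    base m₁ m₂ exchange₀ m₁z = begin
      y * z * (m₂ + y)                    ≡⟨ solve (x ∷ y ∷ z ∷ m₂ ∷ []) ℚ-ring ⟩
      z * (m₂ * y) + z * (y * y)          ≡⟨ cong (λ s → z * s + z * (y * y)) exchange₀ ⟩
      z * (m₁ * m₁ + x * x) + z * (y * y) ≡⟨ solve (x ∷ y ∷ z ∷ m₁ ∷ []) ℚ-ring ⟩
      z * (m₁ * m₁) + z * (x * x + y * y) ≡⟨ cong (λ s → z * (m₁ * m₁) + z * s) m₁z ⟨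
      z * (m₁ * m₁) + z * (m₁ * z)        ≡⟨ solve (z ∷ m₁ ∷ []) ℚ-ring ⟩
      (m₁ * z + z * z) * m₁               ≡⟨ cong (λ s → (s + z * z) * m₁) m₁z ⟩
      (x * x + y * y + z * z) * m₁        ∎

  Q : ℕ → ℚ
  Q k = y ^ k * z ^ suc k * M (suc k)

  Q-rec : ∀ k → Q (suc (suc k)) + y * y * (z * z) * Q k ≡ (x * x + y * y + z * z) * Q (suc k)
  Q-rec k = rescaled (y ^ k) (z ^ suc k) (M (suc k)) (M (suc (suc k))) (M (suc (suc (suc k))))
                     (M-linear (suc k))
    where
    rescaled : ∀ a b m₁ m₂ m₃ → y * z * (m₃ + m₁) ≡ (x * x + y * y + z * z) * m₂ →
      y * (y * a) * (z * (z * b)) * m₃ + y * y * (z * z) * (a * b * m₁)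
        ≡ (x * x + y * y + z * z) * (y * a * (z * b) * m₂)
    rescaled a b m₁ m₂ m₃ linear = begin
      y * (y * a) * (z * (z * b)) * m₃ + y * y * (z * z) * (a * b * m₁)
        ≡⟨ solve (y ∷ z ∷ a ∷ b ∷ m₁ ∷ m₃ ∷ []) ℚ-ring ⟩
      y * a * (z * b) * (y * z * (m₃ + m₁))
        ≡⟨ cong (y * a * (z * b) *_) linear ⟩
      y * a * (z * b) * ((x * x + y * y + z * z) * m₂)
        ≡⟨ solve (x ∷ y ∷ z ∷ a ∷ b ∷ m₂ ∷ []) ℚ-ring ⟩
      (x * x + y * y + z * z) * (y * a * (z * b) * m₂)
        ∎

  Q₀ : Q 0 ≡ x * x + y * y
  Q₀ = trans (reorder z (M 1)) M₁*z
    where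
    reorder : ∀ w m → 1ℚ * (w * 1ℚ) * m ≡ m * w
    reorder = solve-∀ ℚ-ring

  Q₁ : Q 1 ≡ (x * x + y * y) * (x * x + y * y) + z * z * (x * x)
  Q₁ = base (M 1) (M 2) (M-exchange 0) M₁*z
    where
    base : ∀ m₁ m₂ → m₂ * y ≡ m₁ * m₁ + x * x → m₁ * z ≡ x * x + y * y →
           y * 1ℚ * (z * (z * 1ℚ)) * m₂ ≡ (x * x + y * y) * (x * x + y * y) + z * z * (x * x)
    base m₁ m₂ exchange₀ m₁z = begin
      y * 1ℚ * (z * (z * 1ℚ)) * m₂            ≡⟨ solve (y ∷ z ∷ m₂ ∷ []) ℚ-ring ⟩
      z * z * (m₂ * y)                        ≡⟨ cong (z * z *_) exchange₀ ⟩
      z * z * (m₁ * m₁ + x * x)               ≡⟨ solve (x ∷ z ∷ m₁ ∷ []) ℚ-ring ⟩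
      m₁ * z * (m₁ * z) + z * z * (x * x)     ≡⟨ cong (λ s → s * s + z * z * (x * x)) m₁z ⟩
      (x * x + y * y) * (x * x + y * y) + z * z * (x * x) ∎

theorem5p2 : (n : ℕ) (x y z : ℚ) → Positive x → Positive y → Positive z →
    y ^ n * z ^ suc n * M₁/ (suc n) x y z
      ≡ Σ< (suc (suc n)) (λ i → Σ< (suc (suc n)) (λ j →
          A n i j * x ^ (2 Data.Nat.* i) * y ^ (2 Data.Nat.* j)
            * z ^ (2 Data.Nat.* (suc n ∸ i ∸ j))))
theorem5p2 n x y z x>0 y>0 z>0 =
  recurrence-unique (x * x + y * y + z * z) (y * y * (z * z)) Q F Q-rec F-rec
    (trans Q₀ (sym F₀)) (trans Q₁ (sym F₁)) n
  where
  open Markov x y z x>0 y>0 z>0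
  open Expansion x y z
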